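{- Let $k\ge 2$ and $n\ge 1$ be integers. For $0\le i\le k-1$ define $S_i(n)=\sum_{j=0}^{i}F_k(n+k-2-j)$. Consider any configuration of checkers on $\mathbb{Z}$ in which, for each $i=0,1,\dots,k-1$, the cell $-i$ holds exactly $S_{k-i-1}(n)$ checkers. Then some finite sequence of moves starting from this configuration produces a configuration in which cell $n$ holds at least one checker.
   Context: Checkers sit on the cells of $\mathbb{Z}$, each cell holding a nonnegative integer number of checkers. A move consists of choosing a cell $x$ and a direction $e\in\{+1,-1\}$ such that each of the $k$ cells $x,x+e,\dots,x+(k-1)e$ holds at least one checker; then one checker is removed from each of these $k$ cells and one checker is added to cell $x+ke$. The $k$-nacci sequence $F_k$ is defined by $F_k(0)=\cdots=F_k(k-2)=0$, $F_k(k-1)=1$ and $F_k(j+k)=F_k(j)+F_k(j+1)+\cdots+F_k(j+k-1)$ for $j\ge 0$. -}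

module Defs where

open import Data.Nat as ℕ using (ℕ; zero; suc; _∸_)
open import Data.Integer as ℤ using (ℤ; +_; -_; _-_; _*_; _≤?_; _<?_; _≟_)
open import Relation.Nullary.Decidable using (⌊_⌋)
open import Data.Bool using (Bool; true; false; if_then_else_; _∧_)
open import Data.List using (List; []; _∷_; replicate; _++_; drop; map; upTo)
open import Data.Nat.ListAction using (sum)
open import Data.Product using (Σ; ∃; _×_; _,_)
open import Relation.Binary.PropositionalEquality using (_≡_)
open import Relation.Binary.Construct.Closure.ReflexiveTransitive using (Star)

-- Window of k consecutive k-nacci values: kWindow k m = [F_k(m), …, F_k(m+k-1)].
kWindow : ℕ → ℕ → List ℕ
kWindow k zero    = replicate (k ∸ 1) 0 ++ (1 ∷ [])
kWindow k (suc m) = let w = kWindow k m in drop 1 w ++ (sum w ∷ [])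

headOr0 : List ℕ → ℕ
headOr0 []      = 0
headOr0 (x ∷ _) = x

-- The k-nacci sequence F_k (for k ≥ 2): F_k(0)=…=F_k(k-2)=0, F_k(k-1)=1,
-- F_k(j+k) = F_k(j)+…+F_k(j+k-1).
fib : ℕ → ℕ → ℕ
fib k m = headOr0 (kWindow k m)

S : ℕ → ℕ → ℕ → ℕ
S k i n = sum (map (λ j → fib k (n ℕ.+ k ∸ 2 ∸ j)) (upTo (suc i)))

Config : Set
Config = ℤ → ℕ

data Dir : Set where
  plus minus : Dir

dirℤ : Dir → ℤ
dirℤ plus  = + 1
dirℤ minus = - (+ 1)

-- y lies in {x, x+e, …, x+(k-1)e}  iff  0 ≤ (y-x)e < k  (as e = ±1)
inSeg : ℕ → ℤ → Dir → ℤ → Bool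
inSeg k x e y = let d = (y - x) * dirℤ e in ⌊ + 0 ≤? d ⌋ ∧ ⌊ d <? + k ⌋

Legal : ℕ → Config → ℤ → Dir → Set
Legal k c x e = ∀ j → j ℕ.< k → 1 ℕ.≤ c (x ℤ.+ (+ j) * dirℤ e)

applyMove : ℕ → Config → ℤ → Dir → Config
applyMove k c x e y =
  (if inSeg k x e y then c y ∸ 1 else c y)
  ℕ.+ (if ⌊ y ≟ x ℤ.+ (+ k) * dirℤ e ⌋ then 1 else 0)

Move : ℕ → Config → Config → Set
Move k c d = Σ ℤ λ x → Σ Dir λ e → Legal k c x e × (d ≡ applyMove k c x e)

Reachable : ℕ → Config → Config → Set
Reachable k = Star (Move k)

{-# OPTIONS --safe #-}
module Submission where

-- A window of k consecutive cells q, …, q+k-1 holding at least S_0(n+1), …, S_{k-1}(n+1)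
-- checkers can be moved one cell to the right. Every S_j(n+1) has leading term F_k(n+k-1),
-- so F_k(n+k-1) moves from q in the positive direction are legal; they leave at least
-- S_j(n+1) - F_k(n+k-1) = S_{j-1}(n) checkers on q+j and put F_k(n+k-1) = S_{k-1}(n) on q+k,
-- the last equality being the k-nacci recurrence. After n-1 such shifts the window sits at
-- q+n-1 and holds at least S_j(1) ≥ F_k(k-1) = 1 checkers per cell, so one more move puts a
-- checker on q+n+k-1, which is cell n for the initial window q = -(k-1).

open import Defs
open import Data.Nat using (ℕ; zero; suc; _+_; _∸_; _≤_; _<_; z≤n; s≤s)
open import Data.Nat.Properties
open import Data.Nat.ListAction using (sum)
open import Data.Nat.ListAction.Properties using (sum-↭)
open import Data.Integer as ℤ using (ℤ; +_; -_)
import Data.Integer.Properties as ℤ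
open import Algebra.Properties.AbelianGroup ℤ.+-0-abelianGroup using (xyx⁻¹≈y)
open import Data.List using (List; []; _∷_; _++_; map; upTo; drop; replicate; length; applyUpTo; applyDownFrom; reverse)
open import Data.List.Properties
  using (length-++; length-drop; length-replicate; drop-drop; map-applyUpTo; map-upTo; reverse-applyUpTo)
open import Data.List.Relation.Binary.Permutation.Propositional.Properties using (↭-reverse)
open import Data.Bool using (true; false; if_then_else_; _∧_)
open import Data.Bool.Properties using (∧-zeroʳ)
open import Data.Product using (Σ; _×_; _,_)
open import Data.Sum using (inj₁; inj₂)
open import Relation.Nullary.Decidable using (⌊_⌋; isYes≗does; dec-true; dec-false)
open import Relation.Binary.PropositionalEquality using (_≡_; refl; sym; trans; cong; cong₂; subst; module ≡-Reasoning)
open import Relation.Binary.Construct.Closure.ReflexiveTransitive using (ε; _◅_; _◅◅_)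

nth : List ℕ → ℕ → ℕ
nth w i = headOr0 (drop i w)

nth-++ˡ : ∀ (u v : List ℕ) {i} → i < length u → nth (u ++ v) i ≡ nth u i
nth-++ˡ (x ∷ u) v {zero}  _         = refl
nth-++ˡ (x ∷ u) v {suc i} (s≤s i<u) = nth-++ˡ u v i<u

nth-++-length : ∀ (u v : List ℕ) → nth (u ++ v) (length u) ≡ headOr0 v
nth-++-length []      v = refl
nth-++-length (x ∷ u) v = nth-++-length u v

applyUpTo-nth : ∀ (w : List ℕ) → applyUpTo (nth w) (length w) ≡ w
applyUpTo-nth []      = refl
applyUpTo-nth (x ∷ w) = cong (x ∷_) (applyUpTo-nth w)

applyUpTo-cong : ∀ {A : Set} {f g : ℕ → A} n → (∀ {i} → i < n → f i ≡ g i) → applyUpTo f n ≡ applyUpTo g n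
applyUpTo-cong zero    f≡g = refl
applyUpTo-cong (suc n) f≡g = cong₂ _∷_ (f≡g (s≤s z≤n)) (applyUpTo-cong n (λ i<n → f≡g (s≤s i<n)))

-- The offset is added on the right of m so that (suc m + a) ∸ suc j reduces to m + a ∸ j.
applyUpTo-reflect : ∀ {A : Set} (h : ℕ → A) a m →
  applyUpTo (λ j → h (m + a ∸ j)) (suc m) ≡ applyDownFrom (λ i → h (i + a)) (suc m)
applyUpTo-reflect h a zero    = refl
applyUpTo-reflect h a (suc m) = cong (h (suc m + a) ∷_) (applyUpTo-reflect h a m)

sum-applyUpTo-reflect : ∀ (h : ℕ → ℕ) a m →
  sum (applyUpTo (λ j → h (m + a ∸ j)) (suc m)) ≡ sum (applyUpTo (λ i → h (i + a)) (suc m))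
sum-applyUpTo-reflect h a m = begin
  sum (applyUpTo (λ j → h (m + a ∸ j)) (suc m))   ≡⟨ cong sum (applyUpTo-reflect h a m) ⟩
  sum (applyDownFrom g (suc m))                   ≡⟨ cong sum (reverse-applyUpTo g (suc m)) ⟨
  sum (reverse (applyUpTo g (suc m)))             ≡⟨ sum-↭ (↭-reverse (applyUpTo g (suc m))) ⟩
  sum (applyUpTo g (suc m))                       ∎
  where
  open ≡-Reasoning
  g : ℕ → ℕ
  g i = h (i + a)

length-kWindow : ∀ k' m → length (kWindow (suc k') m) ≡ suc k'
length-kWindow k' zero    = begin
  length (replicate k' 0 ++ 1 ∷ [])   ≡⟨ length-++ (replicate k' 0) ⟩
  length (replicate k' 0) + 1         ≡⟨ cong (_+ 1) (length-replicate k') ⟩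
  k' + 1                              ≡⟨ +-comm k' 1 ⟩
  suc k'                              ∎
  where open ≡-Reasoning
length-kWindow k' (suc m) = begin
  length (drop 1 w ++ sum w ∷ [])   ≡⟨ length-++ (drop 1 w) ⟩
  length (drop 1 w) + 1             ≡⟨ cong (_+ 1) (length-drop 1 w) ⟩
  length w ∸ 1 + 1                  ≡⟨ cong (λ l → l ∸ 1 + 1) (length-kWindow k' m) ⟩
  k' + 1                            ≡⟨ +-comm k' 1 ⟩
  suc k'                            ∎
  where
  open ≡-Reasoning
  w = kWindow (suc k') m

length-tail-kWindow : ∀ k' m → length (drop 1 (kWindow (suc k') m)) ≡ k'
length-tail-kWindow k' m = trans (length-drop 1 (kWindow (suc k') m)) (cong (_∸ 1) (length-kWindow k' m))

nth-kWindow : ∀ k' m {i} → i < suc k' → nth (kWindow (suc k') m) i ≡ fib (suc k') (i + m)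
nth-kWindow k' m {zero}  _           = refl
nth-kWindow k' m {suc i} (s≤s i<k') = begin
  nth w (suc i)                        ≡⟨ cong headOr0 (drop-drop 1 i w) ⟨
  nth (drop 1 w) i                     ≡⟨ nth-++ˡ (drop 1 w) _ (subst (i <_) (sym (length-tail-kWindow k' m)) i<k') ⟨
  nth (kWindow (suc k') (suc m)) i     ≡⟨ nth-kWindow k' (suc m) (m≤n⇒m≤1+n i<k') ⟩
  fib (suc k') (i + suc m)             ≡⟨ cong (fib (suc k')) (+-suc i m) ⟩
  fib (suc k') (suc i + m)             ∎
  where
  open ≡-Reasoning
  w = kWindow (suc k') m

kWindow≡applyUpTo : ∀ k' m → kWindow (suc k') m ≡ applyUpTo (λ i → fib (suc k') (i + m)) (suc k')
kWindow≡applyUpTo k' m = begin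
  w                                   ≡⟨ applyUpTo-nth w ⟨
  applyUpTo (nth w) (length w)        ≡⟨ cong (applyUpTo (nth w)) (length-kWindow k' m) ⟩
  applyUpTo (nth w) (suc k')          ≡⟨ applyUpTo-cong (suc k') (nth-kWindow k' m) ⟩
  applyUpTo (λ i → fib (suc k') (i + m)) (suc k') ∎
  where
  open ≡-Reasoning
  w = kWindow (suc k') m

fib-recurrence : ∀ k' m → fib (suc k') (suc k' + m) ≡ sum (applyUpTo (λ i → fib (suc k') (i + m)) (suc k'))
fib-recurrence k' m = begin
  fib (suc k') (suc k' + m)                       ≡⟨ cong (fib (suc k')) (+-suc k' m) ⟨
  fib (suc k') (k' + suc m)                       ≡⟨ nth-kWindow k' (suc m) (n<1+n k') ⟨
  nth (drop 1 w ++ sum w ∷ []) k'                 ≡⟨ cong (nth (drop 1 w ++ sum w ∷ [])) (length-tail-kWindow k' m) ⟨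
  nth (drop 1 w ++ sum w ∷ []) (length (drop 1 w)) ≡⟨ nth-++-length (drop 1 w) (sum w ∷ []) ⟩
  sum w                                           ≡⟨ cong sum (kWindow≡applyUpTo k' m) ⟩
  sum (applyUpTo (λ i → fib (suc k') (i + m)) (suc k')) ∎
  where
  open ≡-Reasoning
  w = kWindow (suc k') m

fib-pred-k≡1 : ∀ k' → fib (suc k') k' ≡ 1
fib-pred-k≡1 k' = begin
  fib (suc k') k'                                     ≡⟨ cong (fib (suc k')) (+-identityʳ k') ⟨
  fib (suc k') (k' + 0)                               ≡⟨ nth-kWindow k' 0 (n<1+n k') ⟨
  nth (replicate k' 0 ++ 1 ∷ []) k'                   ≡⟨ cong (nth (replicate k' 0 ++ 1 ∷ [])) (length-replicate k') ⟨
  nth (replicate k' 0 ++ 1 ∷ []) (length (replicate k' 0)) ≡⟨ nth-++-length (replicate k' 0) (1 ∷ []) ⟩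
  1                                                   ∎
  where open ≡-Reasoning

S-head-≤ : ∀ k i n → fib k (n + k ∸ 2) ≤ S k i n
S-head-≤ k i n = m≤m+n _ _

S-suc : ∀ k i n → S k (suc i) (suc n) ≡ fib k (n + k ∸ 1) + S k i n
S-suc k i n = cong (λ s → fib k (n + k ∸ 1) + s) (cong sum (begin
  map f (applyUpTo suc (suc i))         ≡⟨ map-applyUpTo suc f (suc i) ⟩
  applyUpTo (λ j → f (suc j)) (suc i)   ≡⟨ applyUpTo-cong (suc i) (λ {j} _ → cong (fib k) (shift-index j)) ⟩
  applyUpTo g (suc i)                   ≡⟨ map-upTo g (suc i) ⟨
  map g (upTo (suc i))                  ∎))
  where
  open ≡-Reasoning
  a = n + k
  f g : ℕ → ℕ
  f j = fib k (suc n + k ∸ 2 ∸ j)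
  g j = fib k (n + k ∸ 2 ∸ j)
  shift-index : ∀ j → a ∸ 1 ∸ suc j ≡ a ∸ 2 ∸ j
  shift-index j = trans (∸-+-assoc a 1 (suc j)) (sym (∸-+-assoc a 2 j))

S-last≡fib : ∀ k' m → S (suc k') k' (suc m) ≡ fib (suc k') (m + suc k')
S-last≡fib k' m = begin
  sum (map (λ j → fib k (m + k ∸ 1 ∸ j)) (upTo k))      ≡⟨ cong sum (map-upTo _ k) ⟩
  sum (applyUpTo (λ j → fib k (m + k ∸ 1 ∸ j)) k)      ≡⟨ cong sum (applyUpTo-cong k (λ {j} _ →
                                                            cong (λ l → fib k (l ∸ 1 ∸ j)) (+-comm m k))) ⟩
  sum (applyUpTo (λ j → fib k (k' + m ∸ j)) k)          ≡⟨ sum-applyUpTo-reflect (fib k) m k' ⟩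
  sum (applyUpTo (λ i → fib k (i + m)) k)               ≡⟨ fib-recurrence k' m ⟨
  fib k (k + m)                                         ≡⟨ cong (fib k) (+-comm k m) ⟩
  fib k (m + k)                                         ∎
  where
  open ≡-Reasoning
  k = suc k'

applyMove-pred-≤ : ∀ k c x e y → c y ∸ 1 ≤ applyMove k c x e y
applyMove-pred-≤ k c x e y = ≤-trans (removal-pred-≤ (inSeg k x e y)) (m≤m+n _ _)
  where
  removal-pred-≤ : ∀ b → c y ∸ 1 ≤ (if b then c y ∸ 1 else c y)
  removal-pred-≤ true  = ≤-refl
  removal-pred-≤ false = m∸n≤m (c y) 1

inSeg-landing : ∀ k q → inSeg k q plus (q ℤ.+ + k) ≡ false
inSeg-landing k q = begin
  inSeg k q plus (q ℤ.+ + k)                        ≡⟨ cong (λ d → ⌊ + 0 ℤ.≤? d ⌋ ∧ ⌊ d ℤ.<? + k ⌋) distance ⟩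
  ⌊ + 0 ℤ.≤? + k ⌋ ∧ ⌊ + k ℤ.<? + k ⌋               ≡⟨ cong (⌊ + 0 ℤ.≤? + k ⌋ ∧_) not-beyond ⟩
  ⌊ + 0 ℤ.≤? + k ⌋ ∧ false                          ≡⟨ ∧-zeroʳ ⌊ + 0 ℤ.≤? + k ⌋ ⟩
  false                                             ∎
  where
  open ≡-Reasoning
  distance : (q ℤ.+ + k ℤ.- q) ℤ.* + 1 ≡ + k
  distance = trans (ℤ.*-identityʳ _) (xyx⁻¹≈y q (+ k))
  not-beyond : ⌊ + k ℤ.<? + k ⌋ ≡ false
  not-beyond = trans (isYes≗does (+ k ℤ.<? + k)) (dec-false (+ k ℤ.<? + k) (ℤ.<-irrefl refl))

applyMove-landing : ∀ k c q → applyMove k c q plus (q ℤ.+ + k) ≡ c (q ℤ.+ + k) + 1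
applyMove-landing k c q =
  cong₂ (λ removed added → (if removed then c y ∸ 1 else c y) + (if added then 1 else 0))
        (inSeg-landing k q) lands
  where
  y = q ℤ.+ + k
  lands : ⌊ y ℤ.≟ q ℤ.+ + k ℤ.* + 1 ⌋ ≡ true
  lands = trans (isYes≗does (y ℤ.≟ _)) (dec-true (y ℤ.≟ _) (cong (λ z → q ℤ.+ z) (sym (ℤ.*-identityʳ (+ k)))))

repeat-move : ∀ k t q c → (∀ j → j < k → t ≤ c (q ℤ.+ + j)) →
  Σ Config λ d → Reachable k c d
    × (∀ j → j < k → c (q ℤ.+ + j) ∸ t ≤ d (q ℤ.+ + j))
    × c (q ℤ.+ + k) + t ≤ d (q ℤ.+ + k)
repeat-move k zero    q c _      = c , ε , (λ _ _ → ≤-refl) , ≤-reflexive (+-identityʳ _)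
repeat-move k (suc t) q c enough =
  let d , c′↠d , loss , gain = repeat-move k t q c′ enough′
  in  d , (q , plus , legal , refl) ◅ c′↠d , loss′ d loss , gain′ d gain
  where
  open ≤-Reasoning
  c′ = applyMove k c q plus
  legal : Legal k c q plus
  legal j j<k = subst (λ z → 1 ≤ c (q ℤ.+ z)) (sym (ℤ.*-identityʳ (+ j))) (≤-trans (s≤s z≤n) (enough j j<k))
  enough′ : ∀ j → j < k → t ≤ c′ (q ℤ.+ + j)
  enough′ j j<k = ≤-trans (∸-monoˡ-≤ 1 (enough j j<k)) (applyMove-pred-≤ k c q plus _)
  loss′ : ∀ d → (∀ j → j < k → c′ (q ℤ.+ + j) ∸ t ≤ d (q ℤ.+ + j)) →
          ∀ j → j < k → c (q ℤ.+ + j) ∸ suc t ≤ d (q ℤ.+ + j)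
  loss′ d loss j j<k = begin
    c (q ℤ.+ + j) ∸ suc t     ≡⟨ ∸-+-assoc (c (q ℤ.+ + j)) 1 t ⟨
    c (q ℤ.+ + j) ∸ 1 ∸ t     ≤⟨ ∸-monoˡ-≤ t (applyMove-pred-≤ k c q plus _) ⟩
    c′ (q ℤ.+ + j) ∸ t        ≤⟨ loss j j<k ⟩
    d (q ℤ.+ + j)             ∎
  gain′ : ∀ d → c′ (q ℤ.+ + k) + t ≤ d (q ℤ.+ + k) → c (q ℤ.+ + k) + suc t ≤ d (q ℤ.+ + k)
  gain′ d gain = begin
    c (q ℤ.+ + k) + suc t     ≡⟨ +-assoc (c (q ℤ.+ + k)) 1 t ⟨
    c (q ℤ.+ + k) + 1 + t     ≡⟨ cong (_+ t) (applyMove-landing k c q) ⟨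
    c′ (q ℤ.+ + k) + t        ≤⟨ gain ⟩
    d (q ℤ.+ + k)             ∎

AtLeastS : ℕ → ℕ → ℤ → Config → Set
AtLeastS k n q c = ∀ j → j < k → S k j n ≤ c (q ℤ.+ + j)

shift-window : ∀ k' m q c → AtLeastS (suc k') (suc (suc m)) q c →
  Σ Config λ d → Reachable (suc k') c d × AtLeastS (suc k') (suc m) (q ℤ.+ + 1) d
shift-window k' m q c atLeast =
  let d , c↠d , loss , gain = repeat-move k F q c (λ j j<k → ≤-trans (S-head-≤ k j (suc (suc m))) (atLeast j j<k))
  in  d , c↠d , λ j j<k →
        subst (λ z → S k j (suc m) ≤ d z) (sym (ℤ.+-assoc q (+ 1) (+ j))) (shifted d loss gain j<k)
  where
  open ≤-Reasoning
  k = suc k'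
  F = fib k (m + k)
  shifted : ∀ d → (∀ j → j < k → c (q ℤ.+ + j) ∸ F ≤ d (q ℤ.+ + j)) → c (q ℤ.+ + k) + F ≤ d (q ℤ.+ + k) →
            ∀ {j} → j < k → S k j (suc m) ≤ d (q ℤ.+ + suc j)
  shifted d loss gain {j} (s≤s j≤k') with m≤n⇒m<n∨m≡n j≤k'
  ... | inj₁ j<k' = begin
    S k j (suc m)                    ≡⟨ m+n∸m≡n F (S k j (suc m)) ⟨
    F + S k j (suc m) ∸ F            ≡⟨ cong (_∸ F) (S-suc k j (suc m)) ⟨
    S k (suc j) (suc (suc m)) ∸ F    ≤⟨ ∸-monoˡ-≤ F (atLeast (suc j) (s≤s j<k')) ⟩
    c (q ℤ.+ + suc j) ∸ F            ≤⟨ loss (suc j) (s≤s j<k') ⟩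
    d (q ℤ.+ + suc j)                ∎
  ... | inj₂ refl = begin
    S k k' (suc m)                   ≡⟨ S-last≡fib k' m ⟩
    F                                ≤⟨ m≤n+m F _ ⟩
    c (q ℤ.+ + k) + F                ≤⟨ gain ⟩
    d (q ℤ.+ + k)                    ∎

reach-from-window : ∀ k' m q c → AtLeastS (suc k') (suc m) q c →
  Σ Config λ d → Reachable (suc k') c d × 1 ≤ d (q ℤ.+ + (m + suc k'))
reach-from-window k' zero q c atLeast =
  let d , c↠d , _ , gain = repeat-move (suc k') 1 q c one-each
  in  d , c↠d , ≤-trans (m≤n+m 1 _) gain
  where
  one-each : ∀ j → j < suc k' → 1 ≤ c (q ℤ.+ + j)
  one-each j j<k = ≤-trans (subst (_≤ S (suc k') j 1) (fib-pred-k≡1 k') (S-head-≤ (suc k') j 1)) (atLeast j j<k)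
reach-from-window k' (suc m) q c atLeast =
  let d , c↠d , atLeast′ = shift-window k' m q c atLeast
      e , d↠e , occupied = reach-from-window k' m (q ℤ.+ + 1) d atLeast′
  in  e , c↠d ◅◅ d↠e , subst (λ z → 1 ≤ e z) (ℤ.+-assoc q (+ 1) (+ (m + suc k'))) occupied

-[m]+n≡-[m∸n] : ∀ {m n} → n ≤ m → - (+ m) ℤ.+ + n ≡ - (+ (m ∸ n))
-[m]+n≡-[m∸n] {m} {n} n≤m = trans (ℤ.-m+n≡n⊖m m n) (ℤ.⊖-≤ n≤m)

-[m]+[n+1+m]≡1+n : ∀ m n → - (+ m) ℤ.+ + (n + suc m) ≡ + suc n
-[m]+[n+1+m]≡1+n m n = begin
  - (+ m) ℤ.+ + (n + suc m)   ≡⟨ ℤ.-m+n≡n⊖m m (n + suc m) ⟩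
  (n + suc m) ℤ.⊖ m           ≡⟨ ℤ.⊖-≥ (subst (m ≤_) (sym (+-suc n m)) (m≤n+m m (suc n))) ⟩
  + (n + suc m ∸ m)           ≡⟨ cong (λ l → + (l ∸ m)) (+-suc n m) ⟩
  + (suc n + m ∸ m)           ≡⟨ cong +_ (m+n∸n≡m (suc n) m) ⟩
  + suc n                     ∎
  where open ≡-Reasoning

suc[m]∸[m∸n]∸1≡n : ∀ {m n} → n ≤ m → suc m ∸ (m ∸ n) ∸ 1 ≡ n
suc[m]∸[m∸n]∸1≡n {m} {n} n≤m = trans (cong (_∸ 1) (+-∸-assoc 1 (m∸n≤m m n))) (m∸[m∸n]≡n n≤m)

lemma3 : (k n : ℕ) → 2 ≤ k → 1 ≤ n → (c : Config)
    → (∀ i → i < k → c (- (+ i)) ≡ S k (k ∸ i ∸ 1) n)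
    → Σ Config (λ d → Reachable k c d × 1 ≤ d (+ n))
lemma3 (suc k') (suc m) (s≤s _) (s≤s _) c initial =
  let d , c↠d , occupied = reach-from-window k' m (- (+ k')) c atLeast
  in  d , c↠d , subst (λ z → 1 ≤ d z) (-[m]+[n+1+m]≡1+n k' m) occupied
  where
  atLeast : AtLeastS (suc k') (suc m) (- (+ k')) c
  atLeast j (s≤s j≤k') = ≤-reflexive (begin
    S (suc k') j (suc m)                         ≡⟨ cong (λ i → S (suc k') i (suc m)) (suc[m]∸[m∸n]∸1≡n j≤k') ⟨
    S (suc k') (suc k' ∸ (k' ∸ j) ∸ 1) (suc m)   ≡⟨ initial (k' ∸ j) (s≤s (m∸n≤m k' j)) ⟨
    c (- (+ (k' ∸ j)))                           ≡⟨ cong c (-[m]+n≡-[m∸n] j≤k') ⟨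
    c (- (+ k') ℤ.+ + j)                         ∎)
    where open ≡-Reasoning
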